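{- Let $n\geq k\geq 1$ be integers and let $a$ be the map defined in the context. For any $k$-subsets $S,T$ of $[n]$, the number $c(S,T)$ of $(S,T)$-good pairs equals $\frac{|S\Delta T|}{2}=|S\setminus T|=|T\setminus S|$.
   Context: $[m]=\{1,\dots,m\}$. For a $k$-subset $S$ of $[n]$ define $f(S)\subseteq([n]\setminus[k])\times[k]$ as follows: if $S=[k]$ then $f(S)=\emptyset$; otherwise let $S\setminus[k]=\{x_1,\dots,x_t\}$ with $n\geq x_1>\dots>x_t\geq k+1$ and $[k]\setminus S=\{y_1,\dots,y_t\}$ with $1\leq y_1<\dots<y_t\leq k$, and set $f(S)=\{(x_1,y_1),\dots,(x_t,y_t)\}$. For each $k$-subset $S$ and each pair $(x,y)\in([n]\setminus[k])\times[k]$ define $a(S,(x,y))\in\{0,1,*\}$ by the first applicable rule: (1) if $(x,y)\in f(S)$, then $1$; (2) else if $\max(S)<x$, then $0$; (3) else if there is $z<y$ with $(x,z)\in f(S)$, then $*$; (4) else if $y\in S$, then $0$; (5) else if there is $z<x$ with $(z,y)\in f(S)$, then $0$; (6) else $*$. A pair $(x,y)$ is $(S,T)$-good if $\{a(S,(x,y)),a(T,(x,y))\}=\{0,1\}$, and $c(S,T)$ is the number of $(S,T)$-good pairs. (In the Johnson graph $J(n,k)$, whose vertices are the $k$-subsets of $[n]$ with $S\sim T$ iff $|S\cap T|=k-1$, the distance between $S$ and $T$ is $|S\setminus T|$; thus this map gives words of length $k(n-k)$.) -}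

module Defs where

open import Data.Bool using (Bool; true; false; not; _∧_; _∨_; if_then_else_)
open import Data.Nat using (ℕ; zero; suc; _<ᵇ_; _≡ᵇ_; _⊔_)
open import Data.Product using (_×_; _,_; proj₁; proj₂)
open import Data.List using (List; []; _∷_; map; filter; filterᵇ; zip; upTo; downFrom; length; concatMap; foldr)
open import Data.Vec using (Vec; []; _∷_)
open import Data.Fin.Subset using (Subset)
open import Data.Bool.ListAction using (any)

-- Elements of [n] = {1,…,n} are natural numbers 1..n; a subset S of [n] is a
-- stdlib 'Subset n' (Vec Bool n) whose i-th entry (0-based) says whether i+1 ∈ S.

memB : ∀ {n} → Subset n → ℕ → Bool
memB []      _             = false
memB (b ∷ S) zero          = false
memB (b ∷ S) (suc zero)    = b
memB (b ∷ S) (suc (suc x)) = memB S (suc x)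

range↑ : ℕ → List ℕ
range↑ m = map suc (upTo m)

range↓ : ℕ → List ℕ
range↓ m = map suc (downFrom m)

elems : ∀ {n} → Subset n → List ℕ
elems {n} S = filterᵇ (memB S) (range↑ n)

maxS : ∀ {n} → Subset n → ℕ
maxS S = foldr _⊔_ 0 (elems S)

-- f(S) : the list of pairs (x_i , y_i), with
--   S ∖ [k] = {x_1 > … > x_t},  [k] ∖ S = {y_1 < … < y_t}.
-- (For S = [k] both lists are empty and f(S) = ∅.)
fS : (n k : ℕ) → Subset n → List (ℕ × ℕ)
fS n k S = zip (filterᵇ (λ x → (k <ᵇ x) ∧ memB S x) (range↓ n))
               (filterᵇ (λ y → not (memB S y)) (range↑ k))

pairEq : ℕ × ℕ → ℕ × ℕ → Bool
pairEq (x , y) (x' , y') = (x ≡ᵇ x') ∧ (y ≡ᵇ y')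

inF : (n k : ℕ) → Subset n → ℕ × ℕ → Bool
inF n k S p = any (pairEq p) (fS n k S)

data Letter : Set where
  𝟘 𝟙 ⋆ : Letter

a : (n k : ℕ) → Subset n → ℕ × ℕ → Letter
a n k S (x , y) =
  if inF n k S (x , y) then 𝟙
  else if maxS S <ᵇ x then 𝟘
  else if any (λ q → (proj₁ q ≡ᵇ x) ∧ (proj₂ q <ᵇ y)) (fS n k S) then ⋆
  else if memB S y then 𝟘
  else if any (λ q → (proj₂ q ≡ᵇ y) ∧ (proj₁ q <ᵇ x)) (fS n k S) then 𝟘
  else ⋆

goodLetters : Letter → Letter → Bool
goodLetters 𝟘 𝟙 = true
goodLetters 𝟙 𝟘 = true
goodLetters _ _ = false

pairsNK : ℕ → ℕ → List (ℕ × ℕ)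
pairsNK n k = concatMap (λ x → map (λ y → (x , y)) (range↑ k))
                        (filterᵇ (k <ᵇ_) (range↑ n))

good : (n k : ℕ) → Subset n → Subset n → ℕ × ℕ → Bool
good n k S T p = goodLetters (a n k S p) (a n k T p)

c : (n k : ℕ) → Subset n → Subset n → ℕ
c n k S T = length (filterᵇ (good n k S T) (pairsNK n k))

module Submission where

-- Rule (1) makes a(S, ·) equal to 1 exactly on f(S), so c(S, T) counts the edges e of f(S)
-- with a(T, e) = 0 together with the edges of f(T) with a(S, e) = 0.  Since f(T) pairs
-- T ∖ [k], listed decreasingly, with [k] ∖ T, listed increasingly, any two of its pairs cross, and for
-- an edge (x, y) of f(S) the value of a(T, (x, y)) is decided by comparing x and y with
-- their partners in f(T).  Going through the four cases x ∈ T or not, y ∈ T or not gives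
-- 2·[a(T, e) = 0] = [x ∉ T] + [y ∈ T] + (signed comparisons of the partners in f(S) and
-- f(T) of x and of y).  Summed over f(S) and over f(T) the comparisons cancel, and the
-- remaining terms add up to |S ∖ T| + |T ∖ S|, which is 2 |S ∖ T| because |S| = |T|.

open import Defs
open import Data.Nat using (ℕ; _≤_; _*_)
open import Data.Product using (_×_)
open import Data.Fin.Subset using (Subset; ∣_∣; _─_; _∪_)
open import Relation.Binary.PropositionalEquality using (_≡_)

open import Data.Bool using (Bool; true; false; T; T?; not; _∧_; _∨_; if_then_else_)
open import Data.Bool.ListAction using (any)
open import Data.Bool.Properties using (¬-not; ∧-conicalˡ; ∧-zeroʳ; ∧-identityʳ; T-≡; T-not-≡; T-∧)
open import Data.Fin.Subset using (_∩_)
open import Data.Fin.Subset.Properties using (∩-comm)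
open import Data.List using (List; []; _∷_; [_]; _++_; map; filterᵇ; zip; upTo; applyUpTo; length; foldr; concatMap; cartesianProduct)
open import Data.List.Properties using (map-upTo; upTo-∷ʳ; map-++; length-map; length-upTo)
open import Data.List.Membership.Propositional using (_∈_; _∉_)
open import Data.List.Membership.Propositional.Properties using (∈-map⁺; ∈-map⁻; ∈-upTo⁺; ∈-upTo⁻; ∈-downFrom⁺; ∈-downFrom⁻; ∈-filter⁺; ∈-filter⁻; ∈-cartesianProduct⁺)
open import Data.List.Relation.Unary.Any using (here; there)
open import Data.List.Relation.Unary.All as All using (All; []; _∷_)
open import Data.List.Relation.Unary.AllPairs as AllPairs using (AllPairs; []; _∷_)
import Data.List.Relation.Unary.AllPairs.Properties as AllPairsₚ
open import Data.List.Relation.Unary.Unique.Propositional using (Unique)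
import Data.List.Relation.Unary.Unique.Propositional.Properties as Uniqueₚ
open import Data.Nat using (zero; suc; _+_; _<_; _>_; _<ᵇ_; _≡ᵇ_; _⊔_; z≤n; s≤s)
open import Data.Nat.Properties
open import Data.Product as Product using (_,_; proj₁; proj₂; ∃)
open import Data.Sum using (_⊎_; inj₁; inj₂)
open import Data.Vec using ([]; _∷_)
open import Function using (_∘_; id)
open import Function.Bundles using (Equivalence)
open import Relation.Binary.Definitions using (tri<; tri≈; tri>)
open import Relation.Binary.PropositionalEquality using (refl; sym; trans; cong; cong₂; subst; subst₂; _≢_; module ≡-Reasoning)
open import Relation.Nullary using (¬_; contradiction)
open import Algebra.Properties.CommutativeSemigroup +-commutativeSemigroup using (interchange)

open ≡-Reasoning

⟦_⟧ : Bool → ℕ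
⟦ true ⟧  = 1
⟦ false ⟧ = 0

∑ : {A : Set} → List A → (A → ℕ) → ℕ
∑ []       f = 0
∑ (x ∷ xs) f = f x + ∑ xs f

module _ {A : Set} where

  ∑-cong-∈ : (xs : List A) {f g : A → ℕ} → (∀ x → x ∈ xs → f x ≡ g x) → ∑ xs f ≡ ∑ xs g
  ∑-cong-∈ []       eq = refl
  ∑-cong-∈ (x ∷ xs) eq = cong₂ _+_ (eq x (here refl)) (∑-cong-∈ xs (λ y y∈ → eq y (there y∈)))

  ∑-cong : (xs : List A) {f g : A → ℕ} → (∀ x → f x ≡ g x) → ∑ xs f ≡ ∑ xs g
  ∑-cong xs eq = ∑-cong-∈ xs (λ x _ → eq x)

  ∑-0 : (xs : List A) → ∑ xs (λ _ → 0) ≡ 0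
  ∑-0 []       = refl
  ∑-0 (x ∷ xs) = ∑-0 xs

  ∑-+ : (xs : List A) (f g : A → ℕ) → ∑ xs (λ x → f x + g x) ≡ ∑ xs f + ∑ xs g
  ∑-+ []       f g = refl
  ∑-+ (x ∷ xs) f g = begin
    f x + g x + ∑ xs (λ x → f x + g x)  ≡⟨ cong (f x + g x +_) (∑-+ xs f g) ⟩
    f x + g x + (∑ xs f + ∑ xs g)       ≡⟨ interchange (f x) (g x) _ _ ⟩
    f x + ∑ xs f + (g x + ∑ xs g)       ∎

  ∑-*ˡ : (xs : List A) (c : ℕ) (f : A → ℕ) → ∑ xs (λ x → c * f x) ≡ c * ∑ xs f
  ∑-*ˡ []       c f = sym (*-zeroʳ c)
  ∑-*ˡ (x ∷ xs) c f = trans (cong (c * f x +_) (∑-*ˡ xs c f)) (sym (*-distribˡ-+ c (f x) _))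

  ∑-++ : (xs ys : List A) (f : A → ℕ) → ∑ (xs ++ ys) f ≡ ∑ xs f + ∑ ys f
  ∑-++ []       ys f = refl
  ∑-++ (x ∷ xs) ys f = trans (cong (f x +_) (∑-++ xs ys f)) (sym (+-assoc (f x) _ _))

  ∑-filterᵇ : (P : A → Bool) (xs : List A) (f : A → ℕ) →
    ∑ (filterᵇ P xs) f ≡ ∑ xs (λ x → if P x then f x else 0)
  ∑-filterᵇ P []       f = refl
  ∑-filterᵇ P (x ∷ xs) f with P x
  ... | true  = cong (f x +_) (∑-filterᵇ P xs f)
  ... | false = ∑-filterᵇ P xs f

  length-filterᵇ : (P : A → Bool) (xs : List A) → length (filterᵇ P xs) ≡ ∑ xs (λ x → ⟦ P x ⟧)
  length-filterᵇ P []       = refl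
  length-filterᵇ P (x ∷ xs) with P x
  ... | true  = cong suc (length-filterᵇ P xs)
  ... | false = length-filterᵇ P xs

  ∑-1 : (xs : List A) → ∑ xs (λ _ → 1) ≡ length xs
  ∑-1 []       = refl
  ∑-1 (x ∷ xs) = cong suc (∑-1 xs)

∑-map : {A B : Set} (g : A → B) (xs : List A) (f : B → ℕ) → ∑ (map g xs) f ≡ ∑ xs (f ∘ g)
∑-map g []       f = refl
∑-map g (x ∷ xs) f = cong (f (g x) +_) (∑-map g xs f)

∑-zip : {A B : Set} (xs : List A) (ys : List B) (f : A → ℕ) (g : B → ℕ) → length xs ≡ length ys →
  ∑ (zip xs ys) (λ p → f (proj₁ p) + g (proj₂ p)) ≡ ∑ xs f + ∑ ys g
∑-zip []       []       f g eq = refl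
∑-zip (x ∷ xs) (y ∷ ys) f g eq = begin
  f x + g y + ∑ (zip xs ys) (λ p → f (proj₁ p) + g (proj₂ p))  ≡⟨ cong (f x + g y +_) (∑-zip xs ys f g (suc-injective eq)) ⟩
  f x + g y + (∑ xs f + ∑ ys g)                                 ≡⟨ interchange (f x) (g y) _ _ ⟩
  f x + ∑ xs f + (g y + ∑ ys g)                                 ∎

∈-range↑⁻ : ∀ {n z} → z ∈ range↑ n → 1 ≤ z × z ≤ n
∈-range↑⁻ z∈ with ∈-map⁻ suc z∈
... | w , w∈ , refl = s≤s z≤n , ∈-upTo⁻ w∈

∈-range↑⁺ : ∀ {n z} → 1 ≤ z → z ≤ n → z ∈ range↑ n
∈-range↑⁺ {z = suc w} _ w<n = ∈-map⁺ suc (∈-upTo⁺ w<n)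

∈-range↓⁻ : ∀ {n z} → z ∈ range↓ n → 1 ≤ z × z ≤ n
∈-range↓⁻ z∈ with ∈-map⁻ suc z∈
... | w , w∈ , refl = s≤s z≤n , ∈-downFrom⁻ w∈

∈-range↓⁺ : ∀ {n z} → 1 ≤ z → z ≤ n → z ∈ range↓ n
∈-range↓⁺ {z = suc w} _ w<n = ∈-map⁺ suc (∈-downFrom⁺ w<n)

∑-range↑-suc : ∀ n (f : ℕ → ℕ) → ∑ (range↑ (suc n)) f ≡ f 1 + ∑ (range↑ n) (f ∘ suc)
∑-range↑-suc n f = cong (f 1 +_) (begin
  ∑ (map suc (applyUpTo suc n)) f   ≡⟨ cong (λ xs → ∑ (map suc xs) f) (sym (map-upTo suc n)) ⟩
  ∑ (map suc (range↑ n)) f          ≡⟨ ∑-map suc (range↑ n) f ⟩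
  ∑ (range↑ n) (f ∘ suc)            ∎)

∑-range↑-snoc : ∀ n (f : ℕ → ℕ) → ∑ (range↑ (suc n)) f ≡ ∑ (range↑ n) f + f (suc n)
∑-range↑-snoc n f = begin
  ∑ (map suc (upTo (suc n))) f      ≡⟨ cong (λ xs → ∑ (map suc xs) f) (sym (upTo-∷ʳ n)) ⟩
  ∑ (map suc (upTo n ++ [ n ])) f   ≡⟨ cong (λ xs → ∑ xs f) (map-++ suc (upTo n) [ n ]) ⟩
  ∑ (range↑ n ++ [ suc n ]) f       ≡⟨ ∑-++ (range↑ n) [ suc n ] f ⟩
  ∑ (range↑ n) f + (f (suc n) + 0)  ≡⟨ cong (∑ (range↑ n) f +_) (+-identityʳ (f (suc n))) ⟩
  ∑ (range↑ n) f + f (suc n)        ∎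

∑-range↓ : ∀ n (f : ℕ → ℕ) → ∑ (range↓ n) f ≡ ∑ (range↑ n) f
∑-range↓ zero    f = refl
∑-range↓ (suc n) f = begin
  f (suc n) + ∑ (range↓ n) f  ≡⟨ +-comm (f (suc n)) _ ⟩
  ∑ (range↓ n) f + f (suc n)  ≡⟨ cong (_+ f (suc n)) (∑-range↓ n f) ⟩
  ∑ (range↑ n) f + f (suc n)  ≡⟨ sym (∑-range↑-snoc n f) ⟩
  ∑ (range↑ (suc n)) f        ∎

∑-range↑-truncate : ∀ k n (f : ℕ → ℕ) → k ≤ n →
  ∑ (range↑ n) (λ z → if k <ᵇ z then 0 else f z) ≡ ∑ (range↑ k) f
∑-range↑-truncate zero    n       f _         = trans (∑-cong-∈ (range↑ n) vanish) (∑-0 (range↑ n))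
  where
  vanish : ∀ z → z ∈ range↑ n → (if 0 <ᵇ z then 0 else f z) ≡ 0
  vanish z z∈ with ∈-range↑⁻ z∈
  ... | s≤s _ , _ = refl
∑-range↑-truncate (suc k) (suc n) f (s≤s k≤n) = begin
  ∑ (range↑ (suc n)) (λ z → if suc k <ᵇ z then 0 else f z)  ≡⟨ ∑-range↑-suc n _ ⟩
  f 1 + ∑ (range↑ n) (λ z → if k <ᵇ z then 0 else f (suc z)) ≡⟨ cong (f 1 +_) (∑-range↑-truncate k n (f ∘ suc) k≤n) ⟩
  f 1 + ∑ (range↑ k) (f ∘ suc)                               ≡⟨ sym (∑-range↑-suc k f) ⟩
  ∑ (range↑ (suc k)) f                                       ∎

true≢false : true ≢ false
true≢false ()

<ᵇ-true⇒< : ∀ {m n} → (m <ᵇ n) ≡ true → m < n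
<ᵇ-true⇒< {m} {n} eq = <ᵇ⇒< m n (subst T (sym eq) _)

<⇒<ᵇ-true : ∀ {m n} → m < n → (m <ᵇ n) ≡ true
<⇒<ᵇ-true m<n = Equivalence.to T-≡ (<⇒<ᵇ m<n)

≤⇒<ᵇ-false : ∀ {m n} → n ≤ m → (m <ᵇ n) ≡ false
≤⇒<ᵇ-false n≤m = ¬-not (λ eq → ≤⇒≯ n≤m (<ᵇ-true⇒< eq))

<ᵇ-false⇒≮ : ∀ {m n} → (m <ᵇ n) ≡ false → ¬ m < n
<ᵇ-false⇒≮ eq m<n = true≢false (trans (sym (<⇒<ᵇ-true m<n)) eq)

≡ᵇ-true⇒≡ : ∀ {m n} → (m ≡ᵇ n) ≡ true → m ≡ n
≡ᵇ-true⇒≡ {m} {n} eq = ≡ᵇ⇒≡ m n (subst T (sym eq) _)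

≡ᵇ-refl : ∀ m → (m ≡ᵇ m) ≡ true
≡ᵇ-refl m = Equivalence.to T-≡ (≡⇒≡ᵇ m m refl)

≢⇒≡ᵇ-false : ∀ {m n} → m ≢ n → (m ≡ᵇ n) ≡ false
≢⇒≡ᵇ-false m≢n = ¬-not (λ eq → m≢n (≡ᵇ-true⇒≡ eq))

<ᵇ-dichotomy : ∀ {m n} → m ≢ n →
  ((m <ᵇ n) ≡ true × (n <ᵇ m) ≡ false) ⊎ ((m <ᵇ n) ≡ false × (n <ᵇ m) ≡ true)
<ᵇ-dichotomy {m} {n} m≢n with <-cmp m n
... | tri< m<n _ _ = inj₁ (<⇒<ᵇ-true m<n , ≤⇒<ᵇ-false (<⇒≤ m<n))
... | tri≈ _ m≡n _ = contradiction m≡n m≢n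
... | tri> _ _ n<m = inj₂ (≤⇒<ᵇ-false (<⇒≤ n<m) , <⇒<ᵇ-true n<m)

<ᵇ-irrefl : ∀ m → (m <ᵇ m) ≡ false
<ᵇ-irrefl m = ≤⇒<ᵇ-false {m} {m} ≤-refl

module _ {A : Set} (P : A → Bool) where

  any-false : ∀ {xs} → (∀ {x} → x ∈ xs → P x ≡ false) → any P xs ≡ false
  any-false {[]}     _     = refl
  any-false {x ∷ xs} P≡false rewrite P≡false (here refl) = any-false (P≡false ∘ there)

  any-true : ∀ {xs x} → x ∈ xs → P x ≡ true → any P xs ≡ true
  any-true {x ∷ xs} (here refl) Px rewrite Px = refl
  any-true {x ∷ xs} (there x′∈) Px with P x
  ... | true  = refl
  ... | false = any-true x′∈ Px

  any-sole : ∀ {xs x} → x ∈ xs → (∀ {x′} → x′ ∈ xs → P x′ ≡ true → x′ ≡ x) → any P xs ≡ P x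
  any-sole {x = x} x∈ sole with P x in Px
  ... | true  = any-true x∈ Px
  ... | false = any-false (λ x′∈ → ¬-not (λ Px′ → true≢false (trans (sym Px′) (trans (cong P (sole x′∈ Px′)) Px))))

pairEq-true⇒≡ : ∀ {p q} → pairEq p q ≡ true → p ≡ q
pairEq-true⇒≡ {x , y} {x′ , y′} eq with Equivalence.to T-∧ (subst T (sym eq) _)
... | x≡x′ , y≡y′ = cong₂ _,_ (≡ᵇ⇒≡ x x′ x≡x′) (≡ᵇ⇒≡ y y′ y≡y′)

pairEq-refl : ∀ p → pairEq p p ≡ true
pairEq-refl (x , y) rewrite ≡ᵇ-refl x | ≡ᵇ-refl y = refl

any-pairEq-∈ : ∀ {p F} → p ∈ F → any (pairEq p) F ≡ true
any-pairEq-∈ {p} p∈ = any-true (pairEq p) p∈ (pairEq-refl p)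

any-pairEq-∉ : ∀ {p F} → p ∉ F → any (pairEq p) F ≡ false
any-pairEq-∉ {p} {F} p∉ = any-false (pairEq p) (λ q∈ → ¬-not (λ eq → p∉ (subst (_∈ F) (sym (pairEq-true⇒≡ eq)) q∈)))

pairEq-false : ∀ {p q} → p ≢ q → pairEq p q ≡ false
pairEq-false p≢q = ¬-not (p≢q ∘ pairEq-true⇒≡)

∑-pick : ∀ {U} → Unique U → ∀ {q} → q ∈ U → (h : ℕ × ℕ → ℕ) →
  ∑ U (λ p → if pairEq p q then h p else 0) ≡ h q
∑-pick {r ∷ U} (r∉U ∷ U!) (here refl) h = begin
  (if pairEq r r then h r else 0) + ∑ U (λ p → if pairEq p r then h p else 0)
    ≡⟨ cong₂ _+_ (cong (λ b → if b then h r else 0) (pairEq-refl r)) (∑-cong-∈ U vanish) ⟩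
  h r + ∑ U (λ _ → 0)
    ≡⟨ trans (cong (h r +_) (∑-0 U)) (+-identityʳ (h r)) ⟩
  h r ∎
  where
  vanish : ∀ p → p ∈ U → (if pairEq p r then h p else 0) ≡ 0
  vanish p p∈ rewrite pairEq-false (All.lookup r∉U p∈ ∘ sym) = refl
∑-pick {r ∷ U} (r∉U ∷ U!) (there q∈) h rewrite pairEq-false (All.lookup r∉U q∈) = ∑-pick U! q∈ h

∑-restrict : ∀ {U F} → Unique U → Unique F → All (_∈ U) F → (h : ℕ × ℕ → ℕ) →
  ∑ U (λ p → if any (pairEq p) F then h p else 0) ≡ ∑ F h
∑-restrict {U} {[]}    _  _            _          h = ∑-0 U
∑-restrict {U} {q ∷ F} U! (q∉F ∷ F!) (q∈U ∷ F⊆U) h = begin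
  ∑ U (λ p → if pairEq p q ∨ any (pairEq p) F then h p else 0)
    ≡⟨ ∑-cong U split ⟩
  ∑ U (λ p → (if pairEq p q then h p else 0) + (if any (pairEq p) F then h p else 0))
    ≡⟨ ∑-+ U _ _ ⟩
  ∑ U (λ p → if pairEq p q then h p else 0) + ∑ U (λ p → if any (pairEq p) F then h p else 0)
    ≡⟨ cong₂ _+_ (∑-pick U! q∈U h) (∑-restrict U! F! F⊆U h) ⟩
  h q + ∑ F h ∎
  where
  split : ∀ p → (if pairEq p q ∨ any (pairEq p) F then h p else 0) ≡
                (if pairEq p q then h p else 0) + (if any (pairEq p) F then h p else 0)
  split p with pairEq p q in p≡q
  ... | false = refl
  ... | true rewrite any-pairEq-∉ {p} {F} (λ p∈ → All.lookup q∉F (subst (_∈ F) (pairEq-true⇒≡ p≡q) p∈) refl) =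
    sym (+-identityʳ (h p))

concatMap-pairs≡cartesianProduct : {A B : Set} (xs : List A) (ys : List B) →
  concatMap (λ x → map (λ y → (x , y)) ys) xs ≡ cartesianProduct xs ys
concatMap-pairs≡cartesianProduct []       ys = refl
concatMap-pairs≡cartesianProduct (x ∷ xs) ys = cong (map (x ,_) ys ++_) (concatMap-pairs≡cartesianProduct xs ys)

memB-bounds : ∀ {n} (S : Subset n) {z} → memB S z ≡ true → 1 ≤ z × z ≤ n
memB-bounds (b ∷ S) {suc zero}    _  = s≤s z≤n , s≤s z≤n
memB-bounds (b ∷ S) {suc (suc z)} eq = s≤s z≤n , s≤s (proj₂ (memB-bounds S eq))

∣∣≡∑memB : ∀ {n} (S : Subset n) → ∣ S ∣ ≡ ∑ (range↑ n) (λ z → ⟦ memB S z ⟧)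
∣∣≡∑memB []      = refl
∣∣≡∑memB {suc n} (b ∷ S) = begin
  ∣ b ∷ S ∣                                         ≡⟨ ∣∷∣ b ⟩
  ⟦ b ⟧ + ∑ (range↑ n) (λ z → ⟦ memB S z ⟧)          ≡⟨ cong (⟦ b ⟧ +_) (∑-cong-∈ (range↑ n) shift) ⟩
  ⟦ b ⟧ + ∑ (range↑ n) (λ z → ⟦ memB (b ∷ S) (suc z) ⟧) ≡⟨ sym (∑-range↑-suc n _) ⟩
  ∑ (range↑ (suc n)) (λ z → ⟦ memB (b ∷ S) z ⟧)      ∎
  where
  ∣∷∣ : ∀ b → ∣ b ∷ S ∣ ≡ ⟦ b ⟧ + ∑ (range↑ n) (λ z → ⟦ memB S z ⟧)
  ∣∷∣ true  = cong suc (∣∣≡∑memB S)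
  ∣∷∣ false = ∣∣≡∑memB S
  shift : ∀ z → z ∈ range↑ n → ⟦ memB S z ⟧ ≡ ⟦ memB (b ∷ S) (suc z) ⟧
  shift z z∈ with ∈-range↑⁻ z∈
  ... | s≤s _ , _ = refl

memB-separates : ∀ {n} (S : Subset n) {u v} → memB S u ≡ true → memB S v ≡ false → u ≢ v
memB-separates S u∈S v∉S refl = true≢false (trans (sym u∈S) v∉S)

memB-─ : ∀ {n} (S T : Subset n) z → memB (S ─ T) z ≡ (memB S z ∧ not (memB T z))
memB-─ []      []      z             = refl
memB-─ (b ∷ S) (c ∷ T) zero          = refl
memB-─ (b ∷ S) (true ∷ T)  (suc zero) = sym (∧-zeroʳ b)
memB-─ (b ∷ S) (false ∷ T) (suc zero) = sym (∧-identityʳ b)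
memB-─ (b ∷ S) (c ∷ T) (suc (suc z)) = memB-─ S T (suc z)

memB⇒≤maxS : ∀ {n} (S : Subset n) {z} → memB S z ≡ true → z ≤ maxS S
memB⇒≤maxS {n} S {z} z∈S = ≤foldr⊔ (elems S) (∈-filter⁺ (T? ∘ memB S) z∈[n] (subst T (sym z∈S) _))
  where
  z∈[n] : z ∈ range↑ n
  z∈[n] = ∈-range↑⁺ (proj₁ (memB-bounds S z∈S)) (proj₂ (memB-bounds S z∈S))
  ≤foldr⊔ : (xs : List ℕ) → z ∈ xs → z ≤ foldr _⊔_ 0 xs
  ≤foldr⊔ (x ∷ xs) (here refl) = m≤m⊔n x _
  ≤foldr⊔ (x ∷ xs) (there z∈)  = m≤n⇒m≤o⊔n x (≤foldr⊔ xs z∈)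

∣p∣≡∣p─q∣+∣p∩q∣ : ∀ {n} (p q : Subset n) → ∣ p ∣ ≡ ∣ p ─ q ∣ + ∣ p ∩ q ∣
∣p∣≡∣p─q∣+∣p∩q∣ []          []          = refl
∣p∣≡∣p─q∣+∣p∩q∣ (true ∷ p)  (true ∷ q)  = trans (cong suc (∣p∣≡∣p─q∣+∣p∩q∣ p q)) (sym (+-suc _ _))
∣p∣≡∣p─q∣+∣p∩q∣ (true ∷ p)  (false ∷ q) = cong suc (∣p∣≡∣p─q∣+∣p∩q∣ p q)
∣p∣≡∣p─q∣+∣p∩q∣ (false ∷ p) (true ∷ q)  = ∣p∣≡∣p─q∣+∣p∩q∣ p q
∣p∣≡∣p─q∣+∣p∩q∣ (false ∷ p) (false ∷ q) = ∣p∣≡∣p─q∣+∣p∩q∣ p q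

∣p─q∣≡∣q─p∣ : ∀ {n} (p q : Subset n) → ∣ p ∣ ≡ ∣ q ∣ → ∣ p ─ q ∣ ≡ ∣ q ─ p ∣
∣p─q∣≡∣q─p∣ p q ∣p∣≡∣q∣ = +-cancelʳ-≡ ∣ p ∩ q ∣ _ _ (begin
  ∣ p ─ q ∣ + ∣ p ∩ q ∣  ≡⟨ sym (∣p∣≡∣p─q∣+∣p∩q∣ p q) ⟩
  ∣ p ∣                  ≡⟨ ∣p∣≡∣q∣ ⟩
  ∣ q ∣                  ≡⟨ ∣p∣≡∣p─q∣+∣p∩q∣ q p ⟩
  ∣ q ─ p ∣ + ∣ q ∩ p ∣  ≡⟨ cong (∣ q ─ p ∣ +_) (cong ∣_∣ (∩-comm q p)) ⟩
  ∣ q ─ p ∣ + ∣ p ∩ q ∣  ∎)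

∣p─q∪q─p∣ : ∀ {n} (p q : Subset n) → ∣ (p ─ q) ∪ (q ─ p) ∣ ≡ ∣ p ─ q ∣ + ∣ q ─ p ∣
∣p─q∪q─p∣ []          []          = refl
∣p─q∪q─p∣ (true ∷ p)  (true ∷ q)  = ∣p─q∪q─p∣ p q
∣p─q∪q─p∣ (true ∷ p)  (false ∷ q) = cong suc (∣p─q∪q─p∣ p q)
∣p─q∪q─p∣ (false ∷ p) (true ∷ q)  = trans (cong suc (∣p─q∪q─p∣ p q)) (sym (+-suc _ _))
∣p─q∪q─p∣ (false ∷ p) (false ∷ q) = ∣p─q∪q─p∣ p q

module _ {A B : Set} where

  ∈-zip⁻ : ∀ {xs : List A} {ys : List B} {x y} → (x , y) ∈ zip xs ys → x ∈ xs × y ∈ ys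
  ∈-zip⁻ {_ ∷ _} {_ ∷ _} (here refl) = here refl , here refl
  ∈-zip⁻ {_ ∷ _} {_ ∷ _} (there p∈)  = Product.map there there (∈-zip⁻ p∈)

  ∈-zip⁺ˡ : (xs : List A) (ys : List B) → length xs ≡ length ys →
    ∀ {x} → x ∈ xs → ∃ λ y → (x , y) ∈ zip xs ys
  ∈-zip⁺ˡ (x ∷ xs) (y ∷ ys) _  (here refl) = y , here refl
  ∈-zip⁺ˡ (x ∷ xs) (y ∷ ys) eq (there x∈)  = Product.map₂ there (∈-zip⁺ˡ xs ys (suc-injective eq) x∈)

  ∈-zip⁺ʳ : (xs : List A) (ys : List B) → length xs ≡ length ys →
    ∀ {y} → y ∈ ys → ∃ λ x → (x , y) ∈ zip xs ys
  ∈-zip⁺ʳ (x ∷ xs) (y ∷ ys) _  (here refl) = x , here refl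
  ∈-zip⁺ʳ (x ∷ xs) (y ∷ ys) eq (there y∈)  = Product.map₂ there (∈-zip⁺ʳ xs ys (suc-injective eq) y∈)

-- The shape of f(S): a larger first coordinate goes with a smaller second one.
Crossing : ℕ × ℕ → ℕ × ℕ → Set
Crossing (x , y) (x′ , y′) = x′ < x × y < y′

zip⁺-crossing : ∀ {xs ys} → AllPairs _>_ xs → AllPairs _<_ ys → AllPairs Crossing (zip xs ys)
zip⁺-crossing []           _            = []
zip⁺-crossing (_ ∷ _)      []           = []
zip⁺-crossing (x> ∷ >xs) (y< ∷ <ys) = pointwise x> y< ∷ zip⁺-crossing >xs <ys
  where
  pointwise : ∀ {x y xs ys} → All (x >_) xs → All (y <_) ys → All (Crossing (x , y)) (zip xs ys)
  pointwise []           _            = []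
  pointwise (_ ∷ _)      []           = []
  pointwise (x′< ∷ x>) (y<y′ ∷ y<) = (x′< , y<y′) ∷ pointwise x> y<

module _ {F : List (ℕ × ℕ)} (F-crossing : AllPairs Crossing F) where

  crossing-trichotomy : ∀ {p q} → p ∈ F → q ∈ F → p ≡ q ⊎ Crossing p q ⊎ Crossing q p
  crossing-trichotomy = go F-crossing
    where
    go : ∀ {G} → AllPairs Crossing G → ∀ {p q} → p ∈ G → q ∈ G → p ≡ q ⊎ Crossing p q ⊎ Crossing q p
    go (_ ∷ _)   (here refl) (here refl) = inj₁ refl
    go (p× ∷ _)  (here refl) (there q∈)  = inj₂ (inj₁ (All.lookup p× q∈))
    go (q× ∷ _)  (there p∈)  (here refl) = inj₂ (inj₂ (All.lookup q× p∈))
    go (_ ∷ G×)  (there p∈)  (there q∈)  = go G× p∈ q∈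

  crossing-unique₁ : ∀ {x y y′} → (x , y) ∈ F → (x , y′) ∈ F → y ≡ y′
  crossing-unique₁ p∈ q∈ with crossing-trichotomy p∈ q∈
  ... | inj₁ refl          = refl
  ... | inj₂ (inj₁ (x<x , _)) = contradiction x<x (<-irrefl refl)
  ... | inj₂ (inj₂ (x<x , _)) = contradiction x<x (<-irrefl refl)

  crossing-unique₂ : ∀ {x x′ y} → (x , y) ∈ F → (x′ , y) ∈ F → x ≡ x′
  crossing-unique₂ p∈ q∈ with crossing-trichotomy p∈ q∈
  ... | inj₁ refl          = refl
  ... | inj₂ (inj₁ (_ , y<y)) = contradiction y<y (<-irrefl refl)
  ... | inj₂ (inj₂ (_ , y<y)) = contradiction y<y (<-irrefl refl)

  crossing-distinct : AllPairs _≢_ F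
  crossing-distinct = AllPairs.map (λ { {x , _} (x′<x , _) refl → <-irrefl refl x′<x }) F-crossing

-- 0 is a junk value for an unmatched vertex; mates are only consulted where they exist.
mateʳ : List (ℕ × ℕ) → ℕ → ℕ
mateʳ []              x = 0
mateʳ ((x′ , y) ∷ F) x = if x′ ≡ᵇ x then y else mateʳ F x

mateˡ : List (ℕ × ℕ) → ℕ → ℕ
mateˡ []              y = 0
mateˡ ((x , y′) ∷ F) y = if y′ ≡ᵇ y then x else mateˡ F y

mateʳ-∈ : ∀ {F} → AllPairs Crossing F → ∀ {x y} → (x , y) ∈ F → mateʳ F x ≡ y
mateʳ-∈ {(x , y) ∷ F} _ (here refl) rewrite ≡ᵇ-refl x = refl
mateʳ-∈ {(x′ , y′) ∷ F} (p× ∷ F×) {x} (there p∈)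
  rewrite ≢⇒≡ᵇ-false {x′} {x} (>⇒≢ (proj₁ (All.lookup p× p∈))) = mateʳ-∈ F× p∈

mateˡ-∈ : ∀ {F} → AllPairs Crossing F → ∀ {x y} → (x , y) ∈ F → mateˡ F y ≡ x
mateˡ-∈ {(x , y) ∷ F} _ (here refl) rewrite ≡ᵇ-refl y = refl
mateˡ-∈ {(x′ , y′) ∷ F} (p× ∷ F×) {y = y} (there p∈)
  rewrite ≢⇒≡ᵇ-false {y′} {y} (<⇒≢ (proj₂ (All.lookup p× p∈))) = mateˡ-∈ F× p∈

module Matching (n k : ℕ) where

  largeElems : Subset n → List ℕ
  largeElems S = filterᵇ (λ x → (k <ᵇ x) ∧ memB S x) (range↓ n)

  holes : Subset n → List ℕ
  holes S = filterᵇ (λ y → not (memB S y)) (range↑ k)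

  fS-crossing : (S : Subset n) → AllPairs Crossing (fS n k S)
  fS-crossing S = zip⁺-crossing (AllPairsₚ.filter⁺ _ range↓-decreasing) (AllPairsₚ.filter⁺ _ range↑-increasing)
    where
    range↓-decreasing : AllPairs _>_ (range↓ n)
    range↓-decreasing = AllPairsₚ.map⁺ (AllPairsₚ.applyDownFrom⁺₁ id n (λ j<i _ → s≤s j<i))
    range↑-increasing : AllPairs _<_ (range↑ k)
    range↑-increasing = AllPairsₚ.map⁺ (AllPairsₚ.applyUpTo⁺₁ id k (λ i<j _ → s≤s i<j))

  record Matched (S : Subset n) (x y : ℕ) : Set where
    field
      large   : k < x
      x≤n     : x ≤ n
      x∈S     : memB S x ≡ true
      1≤y     : 1 ≤ y
      y≤k     : y ≤ k
      y∉S     : memB S y ≡ false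

  ∈fS⇒Matched : ∀ S {x y} → (x , y) ∈ fS n k S → Matched S x y
  ∈fS⇒Matched S e∈ with ∈-zip⁻ e∈
  ... | x∈ , y∈ with ∈-filter⁻ (T? ∘ _) {xs = range↓ n} x∈ | ∈-filter⁻ (T? ∘ _) {xs = range↑ k} y∈
  ... | x∈[n] , x-large | y∈[k] , y-hole with Equivalence.to T-∧ x-large
  ... | k<ᵇx , x∈S = record
    { large = <ᵇ⇒< k _ k<ᵇx
    ; x≤n   = proj₂ (∈-range↓⁻ x∈[n])
    ; x∈S   = Equivalence.to T-≡ x∈S
    ; 1≤y   = proj₁ (∈-range↑⁻ y∈[k])
    ; y≤k   = proj₂ (∈-range↑⁻ y∈[k])
    ; y∉S   = Equivalence.to T-not-≡ y-hole
    }

  module _ (S : Subset n) (∣S∣≡k : ∣ S ∣ ≡ k) (k≤n : k ≤ n) where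

    private
      small : ℕ
      small = ∑ (range↑ k) (λ z → ⟦ memB S z ⟧)

      small+large≡k : small + length (largeElems S) ≡ k
      small+large≡k = begin
        small + length (largeElems S)
          ≡⟨ cong₂ _+_ (sym (∑-range↑-truncate k n _ k≤n))
                       (trans (length-filterᵇ _ (range↓ n)) (∑-range↓ n _)) ⟩
        ∑ (range↑ n) (λ z → if k <ᵇ z then 0 else ⟦ memB S z ⟧) + ∑ (range↑ n) (λ z → ⟦ (k <ᵇ z) ∧ memB S z ⟧)
          ≡⟨ sym (∑-+ (range↑ n) _ _) ⟩
        ∑ (range↑ n) (λ z → (if k <ᵇ z then 0 else ⟦ memB S z ⟧) + ⟦ (k <ᵇ z) ∧ memB S z ⟧)
          ≡⟨ ∑-cong (range↑ n) (λ z → split (k <ᵇ z) (memB S z)) ⟩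
        ∑ (range↑ n) (λ z → ⟦ memB S z ⟧)
          ≡⟨ trans (sym (∣∣≡∑memB S)) ∣S∣≡k ⟩
        k ∎
        where
        split : ∀ b s → (if b then 0 else ⟦ s ⟧) + ⟦ b ∧ s ⟧ ≡ ⟦ s ⟧
        split true  s = refl
        split false s = +-identityʳ ⟦ s ⟧

      small+holes≡k : small + length (holes S) ≡ k
      small+holes≡k = begin
        small + length (holes S)
          ≡⟨ cong (small +_) (length-filterᵇ _ (range↑ k)) ⟩
        small + ∑ (range↑ k) (λ z → ⟦ not (memB S z) ⟧)
          ≡⟨ sym (∑-+ (range↑ k) _ _) ⟩
        ∑ (range↑ k) (λ z → ⟦ memB S z ⟧ + ⟦ not (memB S z) ⟧)
          ≡⟨ ∑-cong (range↑ k) (λ z → complement (memB S z)) ⟩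
        ∑ (range↑ k) (λ _ → 1)
          ≡⟨ ∑-1 (range↑ k) ⟩
        length (range↑ k)
          ≡⟨ trans (length-map suc (upTo k)) (length-upTo k) ⟩
        k ∎
        where
        complement : ∀ s → ⟦ s ⟧ + ⟦ not s ⟧ ≡ 1
        complement true  = refl
        complement false = refl

    length-largeElems≡length-holes : length (largeElems S) ≡ length (holes S)
    length-largeElems≡length-holes = +-cancelˡ-≡ small _ _ (trans small+large≡k (sym small+holes≡k))

    matchedˡ : ∀ {x} → k < x → x ≤ n → memB S x ≡ true → ∃ λ y → (x , y) ∈ fS n k S
    matchedˡ k<x x≤n x∈S = ∈-zip⁺ˡ (largeElems S) (holes S) length-largeElems≡length-holes
      (∈-filter⁺ (T? ∘ _) (∈-range↓⁺ (≤-trans (s≤s z≤n) k<x) x≤n)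
                 (Equivalence.from T-∧ (<⇒<ᵇ k<x , Equivalence.from T-≡ x∈S)))

    matchedʳ : ∀ {y} → 1 ≤ y → y ≤ k → memB S y ≡ false → ∃ λ x → (x , y) ∈ fS n k S
    matchedʳ 1≤y y≤k y∉S = ∈-zip⁺ʳ (largeElems S) (holes S) length-largeElems≡length-holes
      (∈-filter⁺ (T? ∘ _) (∈-range↑⁺ 1≤y y≤k) (Equivalence.from T-not-≡ y∉S))

    ∑-fS : (g h : ℕ → ℕ) → ∑ (fS n k S) (λ e → g (proj₁ e) + h (proj₂ e)) ≡
      ∑ (range↑ n) (λ z → (if (k <ᵇ z) ∧ memB S z then g z else 0) + (if k <ᵇ z then 0 else if not (memB S z) then h z else 0))
    ∑-fS g h = begin
      ∑ (zip (largeElems S) (holes S)) (λ e → g (proj₁ e) + h (proj₂ e))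
        ≡⟨ ∑-zip (largeElems S) (holes S) g h length-largeElems≡length-holes ⟩
      ∑ (largeElems S) g + ∑ (holes S) h
        ≡⟨ cong₂ _+_ (trans (∑-filterᵇ _ (range↓ n) g) (∑-range↓ n _))
                     (trans (∑-filterᵇ _ (range↑ k) h) (sym (∑-range↑-truncate k n _ k≤n))) ⟩
      ∑ (range↑ n) (λ z → if (k <ᵇ z) ∧ memB S z then g z else 0) + ∑ (range↑ n) (λ z → if k <ᵇ z then 0 else if not (memB S z) then h z else 0)
        ≡⟨ sym (∑-+ (range↑ n) _ _) ⟩
      _ ∎

isZero : Letter → Bool
isZero 𝟘 = true
isZero _ = false

isOne : Letter → Bool
isOne 𝟙 = true
isOne _ = false

firstRule : Bool → Bool → Bool → Bool → Bool → Letter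
firstRule r₁ r₂ r₃ r₄ r₅ = if r₁ then 𝟙 else if r₂ then 𝟘 else if r₃ then ⋆ else if r₄ then 𝟘 else if r₅ then 𝟘 else ⋆

isOne-firstRule : ∀ r₁ r₂ r₃ r₄ r₅ → isOne (firstRule r₁ r₂ r₃ r₄ r₅) ≡ r₁
isOne-firstRule true  _     _     _     _     = refl
isOne-firstRule false true  _     _     _     = refl
isOne-firstRule false false true  _     _     = refl
isOne-firstRule false false false true  _     = refl
isOne-firstRule false false false false true  = refl
isOne-firstRule false false false false false = refl

goodLetters-split : ∀ l m → ⟦ goodLetters l m ⟧ ≡ (if isOne l then ⟦ isZero m ⟧ else 0) + (if isOne m then ⟦ isZero l ⟧ else 0)
goodLetters-split 𝟘 𝟘 = refl
goodLetters-split 𝟘 𝟙 = refl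
goodLetters-split 𝟘 ⋆ = refl
goodLetters-split 𝟙 𝟘 = refl
goodLetters-split 𝟙 𝟙 = refl
goodLetters-split 𝟙 ⋆ = refl
goodLetters-split ⋆ 𝟘 = refl
goodLetters-split ⋆ 𝟙 = refl
goodLetters-split ⋆ ⋆ = refl

module Letters (n k : ℕ) where
  open Matching n k

  ruleThree : Subset n → ℕ → ℕ → Bool
  ruleThree T x y = any (λ q → (proj₁ q ≡ᵇ x) ∧ (proj₂ q <ᵇ y)) (fS n k T)

  ruleFive : Subset n → ℕ → ℕ → Bool
  ruleFive T x y = any (λ q → (proj₂ q ≡ᵇ y) ∧ (proj₁ q <ᵇ x)) (fS n k T)

  a≡firstRule : ∀ T x y →
    a n k T (x , y) ≡ firstRule (inF n k T (x , y)) (maxS T <ᵇ x) (ruleThree T x y) (memB T y) (ruleFive T x y)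
  a≡firstRule T x y = refl

  isOne-a : ∀ T p → isOne (a n k T p) ≡ inF n k T p
  isOne-a T (x , y) = isOne-firstRule (inF n k T (x , y)) (maxS T <ᵇ x) (ruleThree T x y) (memB T y) (ruleFive T x y)

  module _ (T : Subset n) where

    private
      first∈T : ∀ {u v} → (u , v) ∈ fS n k T → memB T u ≡ true
      first∈T e∈ = Matched.x∈S (∈fS⇒Matched T e∈)

      second∉T : ∀ {u v} → (u , v) ∈ fS n k T → memB T v ≡ false
      second∉T e∈ = Matched.y∉S (∈fS⇒Matched T e∈)

    ∉fS-first : ∀ {x y} → memB T x ≡ false → (x , y) ∉ fS n k T
    ∉fS-first x∉T e∈ = true≢false (trans (sym (first∈T e∈)) x∉T)

    ∉fS-second : ∀ {x y} → memB T y ≡ true → (x , y) ∉ fS n k T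
    ∉fS-second y∈T e∈ = true≢false (trans (sym y∈T) (second∉T e∈))

    ∉fS-mate : ∀ {x y y′} → (x , y′) ∈ fS n k T → y ≢ y′ → (x , y) ∉ fS n k T
    ∉fS-mate mate y≢y′ e∈ = y≢y′ (crossing-unique₁ (fS-crossing T) e∈ mate)

    ruleTwo-∈ : ∀ {x} → memB T x ≡ true → (maxS T <ᵇ x) ≡ false
    ruleTwo-∈ x∈T = ≤⇒<ᵇ-false (memB⇒≤maxS T x∈T)

    ruleThree-∉ : ∀ {x y} → memB T x ≡ false → ruleThree T x y ≡ false
    ruleThree-∉ {x} {y} x∉T = any-false (λ q → (proj₁ q ≡ᵇ x) ∧ (proj₂ q <ᵇ y)) {fS n k T} λ {(u , v)} e∈ → ¬-not λ eq →
      ∉fS-first x∉T (subst (λ w → (w , v) ∈ fS n k T) (≡ᵇ-true⇒≡ {u} {x} (∧-conicalˡ (u ≡ᵇ x) (v <ᵇ y) eq)) e∈)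

    ruleThree-mate : ∀ {x y y′} → (x , y′) ∈ fS n k T → ruleThree T x y ≡ (y′ <ᵇ y)
    ruleThree-mate {x} {y} {y′} e∈ = trans (any-sole _ e∈ sole) (cong (_∧ (y′ <ᵇ y)) (≡ᵇ-refl x))
      where
      sole : ∀ {q} → q ∈ fS n k T → ((proj₁ q ≡ᵇ x) ∧ (proj₂ q <ᵇ y)) ≡ true → q ≡ (x , y′)
      sole {u , v} q∈ eq with ≡ᵇ-true⇒≡ {u} {x} (∧-conicalˡ (u ≡ᵇ x) _ eq)
      ... | refl = cong (x ,_) (crossing-unique₁ (fS-crossing T) q∈ e∈)

    ruleFive-mate : ∀ {x y x′} → (x′ , y) ∈ fS n k T → ruleFive T x y ≡ (x′ <ᵇ x)
    ruleFive-mate {x} {y} {x′} e∈ = trans (any-sole _ e∈ sole) (cong (_∧ (x′ <ᵇ x)) (≡ᵇ-refl y))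
      where
      sole : ∀ {q} → q ∈ fS n k T → ((proj₂ q ≡ᵇ y) ∧ (proj₁ q <ᵇ x)) ≡ true → q ≡ (x′ , y)
      sole {u , v} q∈ eq with ≡ᵇ-true⇒≡ {v} {y} (∧-conicalˡ (v ≡ᵇ y) _ eq)
      ... | refl = cong (_, y) (crossing-unique₂ (fS-crossing T) q∈ e∈)

    inF-∈ : ∀ {p} → p ∈ fS n k T → inF n k T p ≡ true
    inF-∈ = any-pairEq-∈

    inF-∉ : ∀ {p} → p ∉ fS n k T → inF n k T p ≡ false
    inF-∉ = any-pairEq-∉

    isZero-∉∈ : ∀ {x y} → memB T x ≡ false → memB T y ≡ true → isZero (a n k T (x , y)) ≡ true
    isZero-∉∈ {x} {y} x∉T y∈T
      rewrite a≡firstRule T x y | inF-∉ (∉fS-first {y = y} x∉T) | ruleThree-∉ {y = y} x∉T | y∈T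
      with maxS T <ᵇ x
    ... | true  = refl
    ... | false = refl

    isZero-∉∉ : ∀ {x y x′} → memB T x ≡ false → (x′ , y) ∈ fS n k T → isZero (a n k T (x , y)) ≡ (x′ <ᵇ x)
    isZero-∉∉ {x} {y} {x′} x∉T mate
      rewrite a≡firstRule T x y | inF-∉ (∉fS-first {y = y} x∉T) | ruleThree-∉ {y = y} x∉T
            | second∉T mate | ruleFive-mate {x = x} mate
      with maxS T <ᵇ x in max<x | x′ <ᵇ x in x′<x
    ... | true  | true  = refl
    ... | true  | false = contradiction (≤-<-trans (memB⇒≤maxS T (first∈T mate)) (<ᵇ-true⇒< {maxS T} {x} max<x))
                                        (<ᵇ-false⇒≮ {x′} {x} x′<x)
    ... | false | true  = refl
    ... | false | false = refl

    isZero-∈∈ : ∀ {x y y′} → (x , y′) ∈ fS n k T → memB T y ≡ true → isZero (a n k T (x , y)) ≡ not (y′ <ᵇ y)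
    isZero-∈∈ {x} {y} {y′} mate y∈T
      rewrite a≡firstRule T x y | inF-∉ (∉fS-second {x = x} y∈T) | ruleTwo-∈ (first∈T mate)
            | ruleThree-mate {y = y} mate | y∈T
      with y′ <ᵇ y
    ... | true  = refl
    ... | false = refl

    isZero-∈∉ : ∀ {x y x′ y′} → (x , y′) ∈ fS n k T → (x′ , y) ∈ fS n k T → isZero (a n k T (x , y)) ≡ false
    isZero-∈∉ {x} {y} {x′} {y′} mateʳ∈ mateˡ∈ with crossing-trichotomy (fS-crossing T) mateʳ∈ mateˡ∈
    ... | inj₁ refl rewrite a≡firstRule T x y | inF-∈ mateʳ∈ = refl
    ... | inj₂ (inj₁ (_ , y′<y))
      rewrite a≡firstRule T x y | inF-∉ (∉fS-mate mateʳ∈ (<⇒≢ y′<y ∘ sym)) | ruleTwo-∈ (first∈T mateʳ∈)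
            | ruleThree-mate {y = y} mateʳ∈ | <⇒<ᵇ-true y′<y = refl
    ... | inj₂ (inj₂ (x<x′ , y<y′))
      rewrite a≡firstRule T x y | inF-∉ (∉fS-mate mateʳ∈ (<⇒≢ y<y′)) | ruleTwo-∈ (first∈T mateʳ∈)
            | ruleThree-mate {y = y} mateʳ∈ | ≤⇒<ᵇ-false (<⇒≤ y<y′) | second∉T mateˡ∈
            | ruleFive-mate {x = x} mateˡ∈ | ≤⇒<ᵇ-false (<⇒≤ x<x′) = refl

module Balance (n k : ℕ) (k≤n : k ≤ n) where
  open Matching n k
  open Letters n k

  imbalance : Subset n → Subset n → Subset n → ℕ × ℕ → ℕ
  imbalance C A B (x , y) =
    (if memB C x then ⟦ mateʳ (fS n k B) x <ᵇ mateʳ (fS n k A) x ⟧ else 0) +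
    (if not (memB C y) then ⟦ mateˡ (fS n k A) y <ᵇ mateˡ (fS n k B) y ⟧ else 0)

  defect : Subset n → ℕ × ℕ → ℕ
  defect B (x , y) = ⟦ not (memB B x) ⟧ + ⟦ memB B y ⟧

  -- For e = (x, y) ∈ f(A) with B-mates y′ of x and x′ of y this says
  -- 2·[a(B, e) = 0] = [x ∉ B] + [y ∈ B] + sgn(y′ − y) + sgn(x − x′), each sign present only
  -- when the mate exists; negative parts stand on the left so that no subtraction occurs.
  Balanced : Subset n → Subset n → ℕ × ℕ → Set
  Balanced A B e = 2 * ⟦ isZero (a n k B e) ⟧ + imbalance B A B e ≡ defect B e + imbalance B B A e

  module _ (A B : Subset n) {x y : ℕ} (e∈ : (x , y) ∈ fS n k A) where

    balanced-∉∈ : memB B x ≡ false → memB B y ≡ true → Balanced A B (x , y)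
    balanced-∉∈ x∉B y∈B rewrite isZero-∉∈ B x∉B y∈B | x∉B | y∈B = refl

    balanced-∉∉ : ∀ {x′} → memB B x ≡ false → (x′ , y) ∈ fS n k B → Balanced A B (x , y)
    balanced-∉∉ {x′} x∉B mate
      rewrite isZero-∉∉ B x∉B mate | x∉B | Matched.y∉S (∈fS⇒Matched B mate)
            | mateˡ-∈ (fS-crossing A) e∈ | mateˡ-∈ (fS-crossing B) mate
      with <ᵇ-dichotomy (memB-separates B (Matched.x∈S (∈fS⇒Matched B mate)) x∉B)
    ... | inj₁ (x′<x , x≮x′) rewrite x′<x | x≮x′ = refl
    ... | inj₂ (x′≮x , x<x′) rewrite x′≮x | x<x′ = refl

    balanced-∈∈ : ∀ {y′} → (x , y′) ∈ fS n k B → memB B y ≡ true → Balanced A B (x , y)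
    balanced-∈∈ {y′} mate y∈B
      rewrite isZero-∈∈ B mate y∈B | Matched.x∈S (∈fS⇒Matched B mate) | y∈B
            | mateʳ-∈ (fS-crossing A) e∈ | mateʳ-∈ (fS-crossing B) mate
      with <ᵇ-dichotomy (memB-separates B y∈B (Matched.y∉S (∈fS⇒Matched B mate)))
    ... | inj₁ (y<y′ , y′≮y) rewrite y<y′ | y′≮y = refl
    ... | inj₂ (y≮y′ , y′<y) rewrite y≮y′ | y′<y = refl

    balanced-∈∉ : ∀ {x′ y′} → (x , y′) ∈ fS n k B → (x′ , y) ∈ fS n k B → Balanced A B (x , y)
    balanced-∈∉ {x′} {y′} mateʳ∈ mateˡ∈
      rewrite isZero-∈∉ B mateʳ∈ mateˡ∈ | Matched.x∈S (∈fS⇒Matched B mateʳ∈) | Matched.y∉S (∈fS⇒Matched B mateˡ∈)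
            | mateʳ-∈ (fS-crossing A) e∈ | mateʳ-∈ (fS-crossing B) mateʳ∈
            | mateˡ-∈ (fS-crossing A) e∈ | mateˡ-∈ (fS-crossing B) mateˡ∈
      with crossing-trichotomy (fS-crossing B) mateʳ∈ mateˡ∈
    ... | inj₁ refl rewrite <ᵇ-irrefl x | <ᵇ-irrefl y = refl
    ... | inj₂ (inj₁ (x′<x , y′<y))
      rewrite <⇒<ᵇ-true x′<x | <⇒<ᵇ-true y′<y | ≤⇒<ᵇ-false (<⇒≤ x′<x) | ≤⇒<ᵇ-false (<⇒≤ y′<y) = refl
    ... | inj₂ (inj₂ (x<x′ , y<y′))
      rewrite <⇒<ᵇ-true x<x′ | <⇒<ᵇ-true y<y′ | ≤⇒<ᵇ-false (<⇒≤ x<x′) | ≤⇒<ᵇ-false (<⇒≤ y<y′) = refl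

  edge-balance : ∀ A B → ∣ B ∣ ≡ k → ∀ {x y} → (x , y) ∈ fS n k A → Balanced A B (x , y)
  edge-balance A B ∣B∣≡k {x} {y} e∈ = cases (memB B x) refl (memB B y) refl
    where
    m : Matched A x y
    m = ∈fS⇒Matched A e∈
    mateʳ∈ : memB B x ≡ true → ∃ λ y′ → (x , y′) ∈ fS n k B
    mateʳ∈ = matchedˡ B ∣B∣≡k k≤n (Matched.large m) (Matched.x≤n m)
    mateˡ∈ : memB B y ≡ false → ∃ λ x′ → (x′ , y) ∈ fS n k B
    mateˡ∈ = matchedʳ B ∣B∣≡k k≤n (Matched.1≤y m) (Matched.y≤k m)
    cases : ∀ bx → memB B x ≡ bx → ∀ by → memB B y ≡ by → Balanced A B (x , y)
    cases false x∉B true  y∈B = balanced-∉∈ A B e∈ x∉B y∈B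
    cases false x∉B false y∉B = balanced-∉∉ A B e∈ x∉B (proj₂ (mateˡ∈ y∉B))
    cases true  x∈B true  y∈B = balanced-∈∈ A B e∈ (proj₂ (mateʳ∈ x∈B)) y∈B
    cases true  x∈B false y∉B = balanced-∈∉ A B e∈ (proj₂ (mateʳ∈ x∈B)) (proj₂ (mateˡ∈ y∉B))

  zerosOn : Subset n → Subset n → ℕ
  zerosOn A B = ∑ (fS n k A) (λ e → ⟦ isZero (a n k B e) ⟧)

  ∑-balance : ∀ A B → ∣ B ∣ ≡ k →
    2 * zerosOn A B + ∑ (fS n k A) (imbalance B A B) ≡ ∑ (fS n k A) (defect B) + ∑ (fS n k A) (imbalance B B A)
  ∑-balance A B ∣B∣≡k = begin
    2 * zerosOn A B + ∑ F (imbalance B A B)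
      ≡⟨ cong (_+ ∑ F (imbalance B A B)) (sym (∑-*ˡ F 2 _)) ⟩
    ∑ F (λ e → 2 * ⟦ isZero (a n k B e) ⟧) + ∑ F (imbalance B A B)
      ≡⟨ sym (∑-+ F _ _) ⟩
    ∑ F (λ e → 2 * ⟦ isZero (a n k B e) ⟧ + imbalance B A B e)
      ≡⟨ ∑-cong-∈ F (λ { (x , y) e∈ → edge-balance A B ∣B∣≡k e∈ }) ⟩
    ∑ F (λ e → defect B e + imbalance B B A e)
      ≡⟨ ∑-+ F _ _ ⟩
    ∑ F (defect B) + ∑ F (imbalance B B A) ∎
    where
    F : List (ℕ × ℕ)
    F = fS n k A

  -- Both sides collect the same vertices: those above k in A ∩ B and those below k outside
  -- A ∪ B.  This is what makes the comparison terms cancel.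
  ∑-imbalance-swap : ∀ A B → ∣ A ∣ ≡ k → ∣ B ∣ ≡ k → ∀ X Y →
    ∑ (fS n k A) (imbalance B X Y) ≡ ∑ (fS n k B) (imbalance A X Y)
  ∑-imbalance-swap A B ∣A∣≡k ∣B∣≡k X Y = begin
    ∑ (fS n k A) (imbalance B X Y)  ≡⟨ ∑-fS A ∣A∣≡k k≤n _ _ ⟩
    ∑ (range↑ n) _                  ≡⟨ ∑-cong (range↑ n) (λ z → swap (k <ᵇ z) (memB A z) (memB B z) _ _) ⟩
    ∑ (range↑ n) _                  ≡⟨ sym (∑-fS B ∣B∣≡k k≤n _ _) ⟩
    ∑ (fS n k B) (imbalance A X Y)  ∎
    where
    swap : ∀ b s t (u v : ℕ) →
      (if b ∧ s then (if t then u else 0) else 0) + (if b then 0 else if not s then (if not t then v else 0) else 0) ≡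
      (if b ∧ t then (if s then u else 0) else 0) + (if b then 0 else if not t then (if not s then v else 0) else 0)
    swap true  true  true  u v = refl
    swap true  true  false u v = refl
    swap true  false true  u v = refl
    swap true  false false u v = refl
    swap false true  true  u v = refl
    swap false true  false u v = refl
    swap false false true  u v = refl
    swap false false false u v = refl

  ∑-defects : ∀ S T → ∣ S ∣ ≡ k → ∣ T ∣ ≡ k →
    ∑ (fS n k S) (defect T) + ∑ (fS n k T) (defect S) ≡ ∣ S ─ T ∣ + ∣ T ─ S ∣
  ∑-defects S T ∣S∣≡k ∣T∣≡k = begin
    ∑ (fS n k S) (defect T) + ∑ (fS n k T) (defect S)
      ≡⟨ cong₂ _+_ (∑-fS S ∣S∣≡k k≤n _ _) (∑-fS T ∣T∣≡k k≤n _ _) ⟩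
    ∑ (range↑ n) _ + ∑ (range↑ n) _
      ≡⟨ sym (∑-+ (range↑ n) _ _) ⟩
    ∑ (range↑ n) _
      ≡⟨ ∑-cong (range↑ n) (λ z → split (k <ᵇ z) (memB S z) (memB T z)) ⟩
    ∑ (range↑ n) (λ z → ⟦ memB S z ∧ not (memB T z) ⟧ + ⟦ memB T z ∧ not (memB S z) ⟧)
      ≡⟨ ∑-+ (range↑ n) _ _ ⟩
    ∑ (range↑ n) (λ z → ⟦ memB S z ∧ not (memB T z) ⟧) + ∑ (range↑ n) (λ z → ⟦ memB T z ∧ not (memB S z) ⟧)
      ≡⟨ sym (cong₂ _+_ (∣─∣≡∑ S T) (∣─∣≡∑ T S)) ⟩
    ∣ S ─ T ∣ + ∣ T ─ S ∣ ∎
    where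
    ∣─∣≡∑ : ∀ A B → ∣ A ─ B ∣ ≡ ∑ (range↑ n) (λ z → ⟦ memB A z ∧ not (memB B z) ⟧)
    ∣─∣≡∑ A B = trans (∣∣≡∑memB (A ─ B)) (∑-cong (range↑ n) (cong ⟦_⟧ ∘ memB-─ A B))
    split : ∀ b s t →
      ((if b ∧ s then ⟦ not t ⟧ else 0) + (if b then 0 else if not s then ⟦ t ⟧ else 0)) +
      ((if b ∧ t then ⟦ not s ⟧ else 0) + (if b then 0 else if not t then ⟦ s ⟧ else 0))
      ≡ ⟦ s ∧ not t ⟧ + ⟦ t ∧ not s ⟧
    split true  true  true  = refl
    split true  true  false = refl
    split true  false true  = refl
    split true  false false = refl
    split false true  true  = refl
    split false true  false = refl
    split false false true  = refl
    split false false false = refl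

module Counting (n k : ℕ) (k≤n : k ≤ n) where
  open Matching n k
  open Letters n k
  open Balance n k k≤n

  pairsNK≡cartesianProduct : pairsNK n k ≡ cartesianProduct (filterᵇ (k <ᵇ_) (range↑ n)) (range↑ k)
  pairsNK≡cartesianProduct = concatMap-pairs≡cartesianProduct (filterᵇ (k <ᵇ_) (range↑ n)) (range↑ k)

  pairsNK-unique : Unique (pairsNK n k)
  pairsNK-unique = subst Unique (sym pairsNK≡cartesianProduct)
    (Uniqueₚ.cartesianProduct⁺ (Uniqueₚ.filter⁺ _ (range↑-unique n)) (range↑-unique k))
    where
    range↑-unique : ∀ m → Unique (range↑ m)
    range↑-unique m = Uniqueₚ.map⁺ suc-injective (Uniqueₚ.upTo⁺ m)

  fS⊆pairsNK : ∀ S → All (_∈ pairsNK n k) (fS n k S)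
  fS⊆pairsNK S = All.tabulate λ { {x , y} e∈ → in-pairsNK (∈fS⇒Matched S e∈) }
    where
    in-pairsNK : ∀ {x y} → Matched S x y → (x , y) ∈ pairsNK n k
    in-pairsNK m = subst (_ ∈_) (sym pairsNK≡cartesianProduct) (∈-cartesianProduct⁺
      (∈-filter⁺ (T? ∘ (k <ᵇ_)) (∈-range↑⁺ (≤-trans (s≤s z≤n) (Matched.large m)) (Matched.x≤n m)) (<⇒<ᵇ (Matched.large m)))
      (∈-range↑⁺ (Matched.1≤y m) (Matched.y≤k m)))

  c≡zerosOn+zerosOn : ∀ S T → c n k S T ≡ zerosOn S T + zerosOn T S
  c≡zerosOn+zerosOn S T = begin
    length (filterᵇ (good n k S T) U)
      ≡⟨ length-filterᵇ _ U ⟩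
    ∑ U (λ p → ⟦ goodLetters (a n k S p) (a n k T p) ⟧)
      ≡⟨ ∑-cong U split ⟩
    ∑ U (λ p → (if inF n k S p then ⟦ isZero (a n k T p) ⟧ else 0) + (if inF n k T p then ⟦ isZero (a n k S p) ⟧ else 0))
      ≡⟨ ∑-+ U _ _ ⟩
    ∑ U (λ p → if inF n k S p then ⟦ isZero (a n k T p) ⟧ else 0) + ∑ U (λ p → if inF n k T p then ⟦ isZero (a n k S p) ⟧ else 0)
      ≡⟨ cong₂ _+_ (restrict S _) (restrict T _) ⟩
    zerosOn S T + zerosOn T S ∎
    where
    U : List (ℕ × ℕ)
    U = pairsNK n k
    restrict : ∀ A (h : ℕ × ℕ → ℕ) → ∑ U (λ p → if inF n k A p then h p else 0) ≡ ∑ (fS n k A) h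
    restrict A = ∑-restrict pairsNK-unique (crossing-distinct (fS-crossing A)) (fS⊆pairsNK A)
    split : ∀ p → ⟦ goodLetters (a n k S p) (a n k T p) ⟧ ≡
      (if inF n k S p then ⟦ isZero (a n k T p) ⟧ else 0) + (if inF n k T p then ⟦ isZero (a n k S p) ⟧ else 0)
    split p = trans (goodLetters-split (a n k S p) (a n k T p))
      (cong₂ (λ u v → (if u then ⟦ isZero (a n k T p) ⟧ else 0) + (if v then ⟦ isZero (a n k S p) ⟧ else 0))
             (isOne-a S p) (isOne-a T p))

cancel-imbalances : ∀ {u v d e m p} → 2 * u + m ≡ d + p → 2 * v + p ≡ e + m → 2 * (u + v) ≡ d + e
cancel-imbalances {u} {v} {d} {e} {m} {p} eq₁ eq₂ = +-cancelʳ-≡ (m + p) _ _ (begin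
  2 * (u + v) + (m + p)        ≡⟨ cong (_+ (m + p)) (*-distribˡ-+ 2 u v) ⟩
  2 * u + 2 * v + (m + p)      ≡⟨ interchange (2 * u) (2 * v) m p ⟩
  (2 * u + m) + (2 * v + p)    ≡⟨ cong₂ _+_ eq₁ eq₂ ⟩
  (d + p) + (e + m)            ≡⟨ interchange d p e m ⟩
  (d + e) + (p + m)            ≡⟨ cong (d + e +_) (+-comm p m) ⟩
  (d + e) + (m + p)            ∎)

mainTheorem1 : (n k : ℕ) → 1 ≤ k → k ≤ n → (S T : Subset n) →
    ∣ S ∣ ≡ k → ∣ T ∣ ≡ k →
    (2 * c n k S T ≡ ∣ (S ─ T) ∪ (T ─ S) ∣) × (c n k S T ≡ ∣ S ─ T ∣) × (c n k S T ≡ ∣ T ─ S ∣)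
mainTheorem1 n k _ k≤n S T ∣S∣≡k ∣T∣≡k =
  trans 2c≡∣S─T∣+∣T─S∣ (sym (∣p─q∪q─p∣ S T)) , c≡∣S─T∣ , trans c≡∣S─T∣ ∣S─T∣≡∣T─S∣
  where
  open Matching n k
  open Balance n k k≤n
  open Counting n k k≤n

  ∣S─T∣≡∣T─S∣ : ∣ S ─ T ∣ ≡ ∣ T ─ S ∣
  ∣S─T∣≡∣T─S∣ = ∣p─q∣≡∣q─p∣ S T (trans ∣S∣≡k (sym ∣T∣≡k))

  balanceˢ : 2 * zerosOn S T + ∑ (fS n k S) (imbalance T S T) ≡
             ∑ (fS n k S) (defect T) + ∑ (fS n k S) (imbalance T T S)
  balanceˢ = ∑-balance S T ∣T∣≡k

  balanceᵗ : 2 * zerosOn T S + ∑ (fS n k S) (imbalance T T S) ≡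
             ∑ (fS n k T) (defect S) + ∑ (fS n k S) (imbalance T S T)
  balanceᵗ = subst₂ (λ p m → 2 * zerosOn T S + p ≡ ∑ (fS n k T) (defect S) + m)
    (sym (∑-imbalance-swap S T ∣S∣≡k ∣T∣≡k T S)) (sym (∑-imbalance-swap S T ∣S∣≡k ∣T∣≡k S T))
    (∑-balance T S ∣S∣≡k)

  2c≡∣S─T∣+∣T─S∣ : 2 * c n k S T ≡ ∣ S ─ T ∣ + ∣ T ─ S ∣
  2c≡∣S─T∣+∣T─S∣ = begin
    2 * c n k S T
      ≡⟨ cong (2 *_) (c≡zerosOn+zerosOn S T) ⟩
    2 * (zerosOn S T + zerosOn T S)
      ≡⟨ cancel-imbalances {u = zerosOn S T} {v = zerosOn T S} balanceˢ balanceᵗ ⟩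
    ∑ (fS n k S) (defect T) + ∑ (fS n k T) (defect S)
      ≡⟨ ∑-defects S T ∣S∣≡k ∣T∣≡k ⟩
    ∣ S ─ T ∣ + ∣ T ─ S ∣ ∎

  c≡∣S─T∣ : c n k S T ≡ ∣ S ─ T ∣
  c≡∣S─T∣ = *-cancelˡ-≡ _ _ 2 (trans 2c≡∣S─T∣+∣T─S∣
    (cong (∣ S ─ T ∣ +_) (trans (sym ∣S─T∣≡∣T─S∣) (sym (+-identityʳ _)))))
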